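{- Let $q$ be a prime power. If $H$ is an umbrella, then its cycle matroid $M(H)$ belongs to $\mathcal{P}_{1,q}$.
   Context: An umbrella is a graph $H$ consisting of a circuit on $m+1$ vertices $u_0,u_1,\ldots,u_m$ (in this cyclic order) together with, for each $i \in \{1,\ldots,m\}$, zero or more additional edges parallel between $u_0$ and $u_i$. $\mathcal{P}_{1,q}$ is the class of $GF(q)$-representable matroids of pathwidth at most $1$, where $\lambda_M(X) = r_M(X)+r_M(E(M)-X)-r_M(E(M))$, the width of an ordering $(e_1,\ldots,e_n)$ of $E(M)$ is $\max_i\lambda_M(\{e_1,\ldots,e_i\})$, and the pathwidth is the minimum width over orderings. -}

module Defs where

open import Level using (0ℓ)
open import Data.Nat using (ℕ; zero; suc; _+_; _^_; _≤_; _<ᵇ_)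
open import Data.Nat.DivMod using (_mod_)
open import Data.Nat.Primality using (Prime)
open import Data.Fin using (Fin; toℕ) renaming (zero to fzero; suc to fsuc)
open import Data.Fin.Subset using (Subset; _∈_; _∉_; _⊆_; ∁; ∣_∣; ⊤)
open import Data.Fin.Permutation using (Permutation′; _⟨$⟩ˡ_)
open import Data.Vec using (tabulate)
open import Data.Bool using (Bool)
open import Data.Product using (Σ; ∃; _×_; _,_)
open import Data.Sum using (_⊎_)
open import Relation.Nullary using (¬_)
open import Relation.Binary.PropositionalEquality using (_≡_; _≢_; setoid)
open import Function.Definitions using (Injective)
open import Function.Bundles using (Inverse)
open import Algebra.Bundles using (CommutativeRing)
import Algebra.Properties.Monoid.Sum as MonoidSum

IsPrimePower : ℕ → Set
IsPrimePower q = Σ ℕ λ p → Σ ℕ λ k → Prime p × q ≡ p ^ suc k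

-- Fields and finite fields of order q (GF(q) is the unique field of order q)

record IsField (R : CommutativeRing 0ℓ 0ℓ) : Set where
  open CommutativeRing R
  field
    0≉1     : ¬ (0# ≈ 1#)
    inverse : ∀ x → ¬ (x ≈ 0#) → Σ Carrier λ y → (x * y) ≈ 1#

record FiniteField (q : ℕ) : Set₁ where
  field
    ring    : CommutativeRing 0ℓ 0ℓ
    isField : IsField ring
    card    : Inverse (CommutativeRing.setoid ring) (setoid (Fin q))

Graph : ℕ → ℕ → Set
Graph nv ne = Fin ne → Fin nv × Fin nv

Joins : ∀ {nv ne} → Graph nv ne → Fin ne → Fin nv → Fin nv → Set
Joins G e u v = (G e ≡ (u , v)) ⊎ (G e ≡ (v , u))

next : ∀ {m} → Fin (suc m) → Fin (suc m)
next {m} i = suc (toℕ i) mod suc m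

-- A cycle of G using only edges of X: distinct vertices v₀,…,v_k and
-- distinct edges e₀,…,e_k in X with e_i joining v_i and v_{i+1 mod (k+1)}
-- (k = 0: a loop; k = 1: a pair of parallel edges).
record CycleIn {nv ne} (G : Graph nv ne) (X : Subset ne) : Set where
  field
    k         : ℕ
    edge      : Fin (suc k) → Fin ne
    vert      : Fin (suc k) → Fin nv
    edge-inj  : Injective _≡_ _≡_ edge
    vert-inj  : Injective _≡_ _≡_ vert
    edge-in   : ∀ i → edge i ∈ X
    edge-join : ∀ i → Joins G (edge i) (vert i) (vert (next i))

CycleIndep : ∀ {nv ne} → Graph nv ne → Subset ne → Set
CycleIndep G X = ¬ CycleIn G X

-- Matroids on ground set Fin n, given by their independence predicate.

IndepPred : ℕ → Set₁
IndepPred n = Subset n → Set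

IsRank : ∀ {n} → IndepPred n → Subset n → ℕ → Set
IsRank I X k =
  (Σ (Subset _) λ Y → Y ⊆ X × I Y × ∣ Y ∣ ≡ k) ×
  (∀ Y → Y ⊆ X → I Y → ∣ Y ∣ ≤ k)

ConnAtMost : ∀ {n} → IndepPred n → Subset n → ℕ → Set
ConnAtMost I X w =
  ∀ a b c → IsRank I X a → IsRank I (∁ X) b → IsRank I ⊤ c → a + b ≤ c + w

-- the set {e_1, …, e_i} of the first i elements of the ordering σ
-- (σ sends positions to elements)
prefix : ∀ {n} → Permutation′ n → ℕ → Subset n
prefix σ i = tabulate λ e → toℕ (σ ⟨$⟩ˡ e) <ᵇ i

PathwidthAtMost : ∀ {n} → IndepPred n → ℕ → Set
PathwidthAtMost {n} I w =
  Σ (Permutation′ n) λ σ → ∀ i → i ≤ n → ConnAtMost I (prefix σ i) w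

module _ (R : CommutativeRing 0ℓ 0ℓ) where
  open CommutativeRing R
  open MonoidSum +-monoid using (sum)

  ColumnsIndep : ∀ {r n} → (Fin r → Fin n → Carrier) → Subset n → Set
  ColumnsIndep {r} {n} A X =
    ∀ (a : Fin n → Carrier) →
      (∀ e → e ∉ X → a e ≈ 0#) →
      (∀ row → sum (λ e → a e * A row e) ≈ 0#) →
      ∀ e → e ∈ X → a e ≈ 0#

  RepresentableOver : ∀ {n} → IndepPred n → Set
  RepresentableOver {n} I =
    Σ ℕ λ r → Σ (Fin r → Fin n → Carrier) λ A →
      ∀ X → (I X → ColumnsIndep A X) × (ColumnsIndep A X → I X)

InP : ∀ {n} → ℕ → (q : ℕ) → FiniteField q → IndepPred n → Set
InP w q F I =
  RepresentableOver (FiniteField.ring F) I × PathwidthAtMost I w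

-- Umbrellas: vertices u₀,…,u_m are 0,…,m; a circuit of edges c i joining
-- u_i and u_{i+1 mod (m+1)}; every other edge joins u₀ and some u_i, i ≥ 1.

record IsUmbrella {m ne} (H : Graph (suc m) ne) : Set where
  field
    circ      : Fin (suc m) → Fin ne
    circ-inj  : Injective _≡_ _≡_ circ
    circ-join : ∀ i → Joins H (circ i) i (next i)
    spokes    : ∀ e → (∀ i → circ i ≢ e) →
                Σ (Fin m) λ j → Joins H e fzero (fsuc j)

-- Delete the row of u₀ from the signed incidence matrix of H. The columns of a cycle
-- have a vanishing signed sum. A forest can be pruned one pendant edge at a time, the
-- pendant vertex never being u₀; the pendant edge is the only column of the forest with
-- a nonzero entry in that vertex's row, so any vanishing combination of the forest's
-- columns has coefficient 0 there, and by induction everywhere. Hence the matrix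
-- represents M(H) over every field.
--
-- For pathwidth, order the edges by a slot number: first the spokes at u₁, then the
-- rim edge u₁u₂, the spokes at u₂, the rim edge u₂u₃, and so on. Pruning also shows
-- that a forest inside an edge set X has at most as many edges as X touches vertices
-- other than u₀. An initial segment X of the order and its complement touch at most one
-- common such vertex, so r(X) + r(E − X) ≤ m + 1, while the path u₀u₁…u_m gives
-- r(E) ≥ m.

module Submission where

open import Defs

open import Level using (0ℓ)
open import Algebra.Bundles using (CommutativeRing)
import Algebra.Properties.CommutativeMonoid.Sum as CommutativeMonoidSum
import Algebra.Properties.Monoid.Sum as MonoidSum
import Algebra.Properties.Ring as RingProperties
import Algebra.Properties.Semiring.Sum as SemiringSum
open import Data.Bool using (Bool; T; if_then_else_)
open import Data.Bool.Properties using (T-≡)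
open import Data.Empty using (⊥-elim)
open import Data.Fin using (Fin; toℕ; fromℕ<; _≟_) renaming (zero to fzero; suc to fsuc)
import Data.Fin.Properties as FinP
open import Data.Fin.Permutation using (Permutation′; permutation; _⟨$⟩ˡ_)
open import Data.Fin.Subset
  using (Subset; inside; outside; _∈_; _∉_; _⊆_; ∁; ∣_∣; _∪_; _∩_; _─_; ⁅_⁆; Nonempty; Empty)
  renaming (_-_ to _∖_)
open import Data.Fin.Subset.Properties
  using (_∈?_; nonempty?; Empty-unique; ∣⊥∣≡0; ∣⊤∣≡n; ∣p∣≤n; ∣⁅x⁆∣≡1; ∈⊤; x∈⁅x⁆;
         x∈p∪q⁺; x∈p∩q⁻; x∈∁p⇒x∉p; p─q⊆p; p⊆q⇒∣p∣≤∣q∣; p⊂q⇒∣p∣<∣q∣; x∈p∧x≢y⇒x∈p-y; x∈p⇒∣p-x∣<∣p∣)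
import Data.Integer.Properties as ℤ
open import Data.List using (List; filter; allFin)
open import Data.List.Extrema.Nat using (argmax; argmax-all; f[xs]≤f[argmax])
open import Data.List.Membership.Propositional.Properties using (∈-filter⁺; ∈-allFin)
import Data.List.Relation.Unary.All as All
open import Data.List.Relation.Unary.All.Properties using (all-filter)
open import Data.Nat using (ℕ; zero; suc; _≤_; _<_; z≤n; s≤s; z<s; _<?_)
import Data.Nat.Properties as ℕP
open import Data.Nat.DivMod using (_mod_; m<n⇒m%n≡m; n%n≡0)
open import Data.Product using (Σ; ∃; _×_; _,_; proj₁; proj₂)
open import Data.Product.Properties using (≡-dec)
open import Data.Sum using (_⊎_; inj₁; inj₂; [_,_]′; swap)
open import Data.Vec using (tabulate; []; _∷_; here; there)
open import Data.Vec.Properties using (lookup∘tabulate; []=⇒lookup; lookup⇒[]=)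
open import Function using (_∘_; id; Equivalence)
open import Function.Definitions using (Injective)
open import Relation.Binary using (tri<; tri≈; tri>)
open import Relation.Binary.PropositionalEquality using (_≡_; _≢_; refl; sym; trans; cong; subst; subst₂)
open import Relation.Nullary using (¬_; Dec; yes; no; does)
open import Relation.Nullary.Decidable using (⌊_⌋; toWitness; fromWitness; dec-true; dec-false; _×-dec_; _⊎-dec_; ¬?)
open import Relation.Unary using (Pred; Decidable)

toℕ-mod : ∀ {m j} → j ≤ m → toℕ (j mod suc m) ≡ j
toℕ-mod j≤m = trans (FinP.toℕ-fromℕ< _) (m<n⇒m%n≡m (s≤s j≤m))

mod-toℕ : ∀ {m} (i : Fin (suc m)) → toℕ i mod suc m ≡ i
mod-toℕ i = FinP.toℕ-injective (toℕ-mod (FinP.toℕ≤pred[n] i))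

mod-self : ∀ m → suc m mod suc m ≡ fzero
mod-self m = FinP.toℕ-injective (trans (FinP.toℕ-fromℕ< _) (n%n≡0 (suc m)))

toℕ-next : ∀ {k} (i : Fin (suc k)) → toℕ i < k → toℕ (next i) ≡ suc (toℕ i)
toℕ-next i i<k = toℕ-mod i<k

next-last : ∀ {k} (i : Fin (suc k)) → toℕ i ≡ k → next i ≡ fzero
next-last {k} i i≡k = trans (cong (λ j → suc j mod suc k) i≡k) (mod-self k)

∈-tabulate⁺ : ∀ {n} {f : Fin n → Bool} {x} → T (f x) → x ∈ tabulate f
∈-tabulate⁺ {f = f} {x} fx = lookup⇒[]= x (tabulate f) (trans (lookup∘tabulate f x) (Equivalence.to T-≡ fx))

∈-tabulate⁻ : ∀ {n} {f : Fin n → Bool} {x} → x ∈ tabulate f → T (f x)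
∈-tabulate⁻ {f = f} {x} x∈ = Equivalence.from T-≡ (trans (sym (lookup∘tabulate f x)) ([]=⇒lookup x∈))

toSubset : ∀ {n} {P : Pred (Fin n) 0ℓ} → Decidable P → Subset n
toSubset P? = tabulate (λ x → ⌊ P? x ⌋)

∈toSubset⁺ : ∀ {n} {P : Pred (Fin n) 0ℓ} {P? : Decidable P} {x} → P x → x ∈ toSubset P?
∈toSubset⁺ {P? = P?} Px = ∈-tabulate⁺ (fromWitness {a? = P? _} Px)

∈toSubset⁻ : ∀ {n} {P : Pred (Fin n) 0ℓ} {P? : Decidable P} {x} → x ∈ toSubset P? → P x
∈toSubset⁻ {P? = P?} x∈ = toWitness {a? = P? _} (∈-tabulate⁻ x∈)

x∈p─q⇒x∉q : ∀ {n} (p q : Subset n) {x} → x ∈ p ─ q → x ∉ q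
x∈p─q⇒x∉q (inside ∷ p) (outside ∷ q) here ()
x∈p─q⇒x∉q (_ ∷ p) (_ ∷ q) (there x∈p─q) (there x∈q) = x∈p─q⇒x∉q p q x∈p─q x∈q

-- Graphs, cycles and pruning

module _ {nv ne : ℕ} (G : Graph nv ne) where

  Incident : Fin ne → Fin nv → Set
  Incident e v = proj₁ (G e) ≡ v ⊎ proj₂ (G e) ≡ v

  IsLinkAt : Fin ne → Fin nv → Set
  IsLinkAt e v = (proj₁ (G e) ≡ v × proj₂ (G e) ≢ v) ⊎ (proj₂ (G e) ≡ v × proj₁ (G e) ≢ v)

  incident? : ∀ e v → Dec (Incident e v)
  incident? e v = (proj₁ (G e) ≟ v) ⊎-dec (proj₂ (G e) ≟ v)

  joins? : ∀ e x y → Dec (Joins G e x y)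
  joins? e x y = ≡-dec _≟_ _≟_ (G e) (x , y) ⊎-dec ≡-dec _≟_ _≟_ (G e) (y , x)

  joins-sym : ∀ {e x y} → Joins G e x y → Joins G e y x
  joins-sym = swap

  joins-ends : ∀ {e x y x′ y′} → Joins G e x y → Joins G e x′ y′ →
               (x ≡ x′ × y ≡ y′) ⊎ (x ≡ y′ × y ≡ x′)
  joins-ends (inj₁ p) (inj₁ q) with trans (sym p) q
  ... | refl = inj₁ (refl , refl)
  joins-ends (inj₁ p) (inj₂ q) with trans (sym p) q
  ... | refl = inj₂ (refl , refl)
  joins-ends (inj₂ p) (inj₁ q) with trans (sym p) q
  ... | refl = inj₂ (refl , refl)
  joins-ends (inj₂ p) (inj₂ q) with trans (sym p) q
  ... | refl = inj₁ (refl , refl)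

  joins-incident : ∀ {e x y v} → Joins G e x y → Incident e v → v ≡ x ⊎ v ≡ y
  joins-incident (inj₁ p) (inj₁ q) = inj₁ (trans (sym q) (cong proj₁ p))
  joins-incident (inj₁ p) (inj₂ q) = inj₂ (trans (sym q) (cong proj₂ p))
  joins-incident (inj₂ p) (inj₁ q) = inj₂ (trans (sym q) (cong proj₁ p))
  joins-incident (inj₂ p) (inj₂ q) = inj₁ (trans (sym q) (cong proj₂ p))

  joins-link : ∀ {e x y} → Joins G e x y → x ≢ y → IsLinkAt e y
  joins-link (inj₁ p) x≢y = inj₂ (cong proj₂ p , λ x≡y → x≢y (trans (sym (cong proj₁ p)) x≡y))
  joins-link (inj₂ p) x≢y = inj₁ (cong proj₁ p , λ x≡y → x≢y (trans (sym (cong proj₂ p)) x≡y))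

  link⇒incident : ∀ {e v} → IsLinkAt e v → Incident e v
  link⇒incident = [ inj₁ ∘ proj₁ , inj₂ ∘ proj₁ ]′

  cycle-mono : ∀ {X Y} → X ⊆ Y → CycleIn G X → CycleIn G Y
  cycle-mono X⊆Y c = record { CycleIn c ; edge-in = λ i → X⊆Y (CycleIn.edge-in c i) }

  cycle-from : ∀ {X} k (E : ℕ → Fin ne) (e : Fin ne) (V : ℕ → Fin nv) →
               (∀ {i} → i < k → E i ∈ X) → e ∈ X →
               (∀ {i} → i < k → Joins G (E i) (V i) (V (suc i))) → Joins G e (V k) (V 0) →
               (∀ {i j} → i < k → j < k → E i ≡ E j → i ≡ j) → (∀ {i} → i < k → E i ≢ e) →
               (∀ {i j} → i ≤ k → j ≤ k → V i ≡ V j → i ≡ j) →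
               CycleIn G X
  cycle-from {X} k E e V E∈X e∈X E-joins e-joins E-injective E≢e V-injective = record
    { k         = k
    ; edge      = edge
    ; vert      = V ∘ toℕ
    ; edge-inj  = edge-injective
    ; vert-inj  = λ eq → FinP.toℕ-injective (V-injective (FinP.toℕ≤pred[n] _) (FinP.toℕ≤pred[n] _) eq)
    ; edge-in   = edge-in
    ; edge-join = edge-join
    }
    where
    toℕ≡k : ∀ {i : Fin (suc k)} → ¬ toℕ i < k → toℕ i ≡ k
    toℕ≡k i≮k = ℕP.≤-antisym (FinP.toℕ≤pred[n] _) (ℕP.≮⇒≥ i≮k)

    edge : Fin (suc k) → Fin ne
    edge i with toℕ i <? k
    ... | yes _ = E (toℕ i)
    ... | no  _ = e

    edge-in : ∀ i → edge i ∈ X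
    edge-in i with toℕ i <? k
    ... | yes i<k = E∈X i<k
    ... | no  _   = e∈X

    edge-join : ∀ i → Joins G (edge i) (V (toℕ i)) (V (toℕ (next i)))
    edge-join i with toℕ i <? k
    ... | yes i<k rewrite toℕ-next i i<k = E-joins i<k
    ... | no  i≮k rewrite next-last i (toℕ≡k i≮k) | toℕ≡k i≮k = e-joins

    edge-injective : Injective _≡_ _≡_ edge
    edge-injective {i} {j} eq with toℕ i <? k | toℕ j <? k
    ... | yes i<k | yes j<k = FinP.toℕ-injective (E-injective i<k j<k eq)
    ... | yes i<k | no  _   = ⊥-elim (E≢e i<k eq)
    ... | no  _   | yes j<k = ⊥-elim (E≢e j<k (sym eq))
    ... | no  i≮k | no  j≮k = FinP.toℕ-injective (trans (toℕ≡k i≮k) (sym (toℕ≡k j≮k)))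

module _ {m ne : ℕ} (G : Graph (suc m) ne) where

  -- The pendant vertex fsuc vertex is never the root 0, whose row the incidence matrix omits.
  record Pendant (X : Subset ne) : Set where
    field
      edge   : Fin ne
      vertex : Fin m
      edge∈X : edge ∈ X
      link   : IsLinkAt G edge (fsuc vertex)
      alone  : ∀ {e} → e ∈ X → e ≢ edge → ¬ Incident G e (fsuc vertex)

  data Prunable : Subset ne → Set where
    empty : ∀ {X} → Empty X → Prunable X
    prune : ∀ {X} (p : Pendant X) → Prunable (X ∖ Pendant.edge p) → Prunable X

  pendants⇒prunable : ∀ {X} → (∀ {Y} → Y ⊆ X → Nonempty Y → Pendant Y) → Prunable X
  pendants⇒prunable {X} pendant = go (suc ∣ X ∣) ℕP.≤-refl id
    where
    go : ∀ n {Y} → ∣ Y ∣ < n → Y ⊆ X → Prunable Y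
    go (suc n) {Y} ∣Y∣<1+n Y⊆X with nonempty? Y
    ... | no  Y-empty    = empty Y-empty
    ... | yes Y-nonempty = prune p (go n smaller (λ x∈ → Y⊆X (p─q⊆p Y _ x∈)))
      where
      p : Pendant Y
      p = pendant Y⊆X Y-nonempty
      smaller : ∣ Y ∖ Pendant.edge p ∣ < n
      smaller = ℕP.<-≤-trans (x∈p⇒∣p-x∣<∣p∣ (Pendant.edge∈X p)) (ℕP.≤-pred ∣Y∣<1+n)

-- The signed incidence matrix

module IncidenceMatrix (R : CommutativeRing 0ℓ 0ℓ) where

  open CommutativeRing R hiding (refl; sym; trans)
  open CommutativeRing R using () renaming (refl to ≈-refl; sym to ≈-sym; trans to ≈-trans)
  open MonoidSum +-monoid using (sum; sum-cong-≋; sum-replicate-zero)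
  open CommutativeMonoidSum +-commutativeMonoid using (sum-remove; ∑-comm)
  open SemiringSum semiring using (*-distribʳ-sum)
  open RingProperties ring using (-1*x≈-x; -0#≈0#; -‿involutive; ⁻¹-anti-homo‿-)
  open import Relation.Binary.Reasoning.Setoid setoid

  sum-zero : ∀ {n} (f : Fin n → Carrier) → (∀ i → f i ≈ 0#) → sum f ≈ 0#
  sum-zero {n} f f≈0 = ≈-trans (sum-cong-≋ f≈0) (sum-replicate-zero n)

  sum-single : ∀ {n} (f : Fin n → Carrier) i → (∀ j → j ≢ i → f j ≈ 0#) → sum f ≈ f i
  sum-single {suc n} f i others = begin
    sum f                               ≈⟨ sum-remove {i = i} f ⟩
    f i + sum (f ∘ Data.Fin.punchIn i)  ≈⟨ +-congˡ (sum-zero _ (λ j → others _ (FinP.punchInᵢ≢i i j))) ⟩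
    f i + 0#                            ≈⟨ +-identityʳ (f i) ⟩
    f i                                 ∎

  [a-b]+[b-c]≈a-c : ∀ a b c → (a - b) + (b - c) ≈ a - c
  [a-b]+[b-c]≈a-c a b c = begin
    (a - b) + (b - c)    ≈⟨ +-assoc a (- b) (b - c) ⟩
    a + (- b + (b - c))  ≈⟨ +-congˡ (≈-sym (+-assoc (- b) b (- c))) ⟩
    a + ((- b + b) - c)  ≈⟨ +-congˡ (+-congʳ (-‿inverseˡ b)) ⟩
    a + (0# - c)         ≈⟨ +-congˡ (+-identityˡ (- c)) ⟩
    a - c                ∎

  ∑-telescope : ∀ n (g : ℕ → Carrier) → sum (λ (i : Fin n) → g (toℕ i) - g (suc (toℕ i))) ≈ g 0 - g n
  ∑-telescope zero    g = ≈-sym (-‿inverseʳ (g 0))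
  ∑-telescope (suc n) g = ≈-trans (+-congˡ (∑-telescope n (g ∘ suc))) ([a-b]+[b-c]≈a-c (g 0) (g 1) (g (suc n)))

  ∑-cyclic-difference : ∀ {k} (f : Fin (suc k) → Carrier) → sum (λ i → f i - f (next i)) ≈ 0#
  ∑-cyclic-difference {k} f = begin
    sum (λ i → f i - f (next i))                             ≈⟨ sum-cong-≋ {suc k} f≈g∘toℕ ⟩
    sum (λ (i : Fin (suc k)) → g (toℕ i) - g (suc (toℕ i)))  ≈⟨ ∑-telescope (suc k) g ⟩
    g 0 - g (suc k)                                          ≈⟨ +-congˡ (-‿cong (reflexive (cong f (mod-self k)))) ⟩
    g 0 - g 0                                                ≈⟨ -‿inverseʳ (g 0) ⟩
    0#                                                       ∎
    where
    g : ℕ → Carrier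
    g j = f (j mod suc k)
    f≈g∘toℕ : ∀ i → f i - f (next i) ≈ g (toℕ i) - g (suc (toℕ i))
    f≈g∘toℕ i = +-congʳ (reflexive (cong f (sym (mod-toℕ i))))

  δ : ∀ {n} → Fin n → Fin n → Carrier
  δ x y = if does (x ≟ y) then 1# else 0#

  δ-≡ : ∀ {n} {x y : Fin n} → x ≡ y → δ x y ≈ 1#
  δ-≡ {x = x} {y} x≡y = reflexive (cong (λ b → if b then 1# else 0#) (dec-true (x ≟ y) x≡y))

  δ-≢ : ∀ {n} {x y : Fin n} → x ≢ y → δ x y ≈ 0#
  δ-≢ {x = x} {y} x≢y = reflexive (cong (λ b → if b then 1# else 0#) (dec-false (x ≟ y) x≢y))

  δ-refl-* : ∀ {n} (x : Fin n) y → δ x x * y ≈ y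
  δ-refl-* x y = ≈-trans (*-congʳ (δ-≡ {x = x} refl)) (*-identityˡ y)

  δ-≢-* : ∀ {n} {x x′ : Fin n} {y} → x ≢ x′ → δ x x′ * y ≈ 0#
  δ-≢-* x≢x′ = ≈-trans (*-congʳ (δ-≢ x≢x′)) (zeroˡ _)

  IsUnit± : Carrier → Set
  IsUnit± s = s ≈ 1# ⊎ s ≈ - 1#

  x*±1≈0⇒x≈0 : ∀ {x s} → IsUnit± s → x * s ≈ 0# → x ≈ 0#
  x*±1≈0⇒x≈0 {x} {s} (inj₁ s≈1) xs≈0 = begin
    x       ≈⟨ ≈-sym (*-identityʳ x) ⟩
    x * 1#  ≈⟨ *-congˡ (≈-sym s≈1) ⟩
    x * s   ≈⟨ xs≈0 ⟩
    0#      ∎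
  x*±1≈0⇒x≈0 {x} {s} (inj₂ s≈-1) xs≈0 = begin
    x          ≈⟨ ≈-sym (-‿involutive x) ⟩
    - (- x)    ≈⟨ -‿cong (≈-sym (-1*x≈-x x)) ⟩
    - (- 1# * x) ≈⟨ -‿cong (*-comm (- 1#) x) ⟩
    - (x * - 1#) ≈⟨ -‿cong (*-congˡ (≈-sym s≈-1)) ⟩
    - (x * s)  ≈⟨ -‿cong xs≈0 ⟩
    - 0#       ≈⟨ -0#≈0# ⟩
    0#         ∎

  ±1≉0 : ¬ (0# ≈ 1#) → ∀ {s} → IsUnit± s → ¬ (s ≈ 0#)
  ±1≉0 0≉1 s-unit s≈0 = 0≉1 (≈-sym (x*±1≈0⇒x≈0 s-unit (≈-trans (*-identityˡ _) s≈0)))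

  module _ {m ne : ℕ} (G : Graph (suc m) ne) where

    incidence : Fin m → Fin ne → Carrier
    incidence v e = δ (proj₁ (G e)) (fsuc v) - δ (proj₂ (G e)) (fsuc v)

    incidence-≈0 : ∀ {v e} → ¬ Incident G e (fsuc v) → incidence v e ≈ 0#
    incidence-≈0 ¬inc = begin
      _ - _    ≈⟨ +-cong (δ-≢ (¬inc ∘ inj₁)) (-‿cong (δ-≢ (¬inc ∘ inj₂))) ⟩
      0# - 0#  ≈⟨ -‿inverseʳ 0# ⟩
      0#       ∎

    incidence-±1 : ∀ {v e} → IsLinkAt G e (fsuc v) → IsUnit± (incidence v e)
    incidence-±1 (inj₁ (tail≡v , head≢v)) =
      inj₁ (≈-trans (+-cong (δ-≡ tail≡v) (-‿cong (δ-≢ head≢v))) (≈-trans (+-congˡ -0#≈0#) (+-identityʳ 1#)))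
    incidence-±1 (inj₂ (head≡v , tail≢v)) =
      inj₂ (≈-trans (+-cong (δ-≢ tail≢v) (-‿cong (δ-≡ head≡v))) (+-identityˡ (- 1#)))

    pendant-coefficient : ∀ {X} (p : Pendant G X) (a : Fin ne → Carrier) → (∀ e → e ∉ X → a e ≈ 0#) →
                          sum (λ e → a e * incidence (Pendant.vertex p) e) ≈ 0# → a (Pendant.edge p) ≈ 0#
    pendant-coefficient {X} p a zero-off row = x*±1≈0⇒x≈0 (incidence-±1 link) (begin
      a edge * incidence vertex edge         ≈⟨ ≈-sym (sum-single _ edge others≈0) ⟩
      sum (λ e → a e * incidence vertex e)   ≈⟨ row ⟩
      0#                                     ∎)
      where
      open Pendant p
      others≈0 : ∀ e → e ≢ edge → a e * incidence vertex e ≈ 0#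
      others≈0 e e≢edge with e ∈? X
      ... | yes e∈X = ≈-trans (*-congˡ (incidence-≈0 (alone e∈X e≢edge))) (zeroʳ (a e))
      ... | no  e∉X = ≈-trans (*-congʳ (zero-off e e∉X)) (zeroˡ _)

    prunable⇒independent : ∀ {X} → Prunable G X → ColumnsIndep R incidence X
    prunable⇒independent (empty X-empty) _ _ _ e e∈X = ⊥-elim (X-empty (e , e∈X))
    prunable⇒independent {X} (prune p rest) a zero-off rows = vanishes
      where
      open Pendant p
      zero-off′ : ∀ e → e ∉ X ∖ edge → a e ≈ 0#
      zero-off′ e e∉ with e ≟ edge
      ... | yes refl    = pendant-coefficient p a zero-off (rows vertex)
      ... | no  e≢edge  = zero-off e (λ e∈X → e∉ (x∈p∧x≢y⇒x∈p-y e∈X e≢edge))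
      vanishes : ∀ e → e ∈ X → a e ≈ 0#
      vanishes e _ with e ∈? X ∖ edge
      ... | yes e∈ = prunable⇒independent rest a zero-off′ rows e e∈
      ... | no  e∉ = zero-off′ e e∉

    module _ {X} (c : CycleIn G X) where
      open CycleIn c

      sign : Fin (suc k) → Carrier
      sign i = [ (λ _ → 1#) , (λ _ → - 1#) ]′ (edge-join i)

      sign-±1 : ∀ i → IsUnit± (sign i)
      sign-±1 i with edge-join i
      ... | inj₁ _ = inj₁ ≈-refl
      ... | inj₂ _ = inj₂ ≈-refl

      coefficient : Fin ne → Carrier
      coefficient e = sum (λ i → δ (edge i) e * sign i)

      coefficient-edge : ∀ i → coefficient (edge i) ≈ sign i
      coefficient-edge i = begin
        sum (λ j → δ (edge j) (edge i) * sign j)  ≈⟨ sum-single _ i (λ j j≢i → δ-≢-* {y = sign j} (j≢i ∘ edge-inj)) ⟩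
        δ (edge i) (edge i) * sign i              ≈⟨ δ-refl-* (edge i) (sign i) ⟩
        sign i                                    ∎

      coefficient-outside : ∀ e → e ∉ X → coefficient e ≈ 0#
      coefficient-outside e e∉X =
        sum-zero (λ i → δ (edge i) e * sign i) (λ i → δ-≢-* (λ eq → e∉X (subst (_∈ X) eq (edge-in i))))

      ∑-coefficient : ∀ (f : Fin ne → Carrier) → sum (λ e → coefficient e * f e) ≈ sum (λ i → sign i * f (edge i))
      ∑-coefficient f = begin
        sum (λ e → coefficient e * f e)                        ≈⟨ sum-cong-≋ (λ e → *-distribʳ-sum (f e) (term e)) ⟩
        sum (λ e → sum (λ i → δ (edge i) e * sign i * f e))    ≈⟨ ∑-comm (λ e i → δ (edge i) e * sign i * f e) ⟩
        sum (λ i → sum (λ e → δ (edge i) e * sign i * f e))    ≈⟨ sum-cong-≋ (λ i → sum-single _ (edge i) (other i)) ⟩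
        sum (λ i → δ (edge i) (edge i) * sign i * f (edge i))  ≈⟨ sum-cong-≋ (λ i → *-congʳ {f (edge i)} (δ-refl-* (edge i) (sign i))) ⟩
        sum (λ i → sign i * f (edge i))                        ∎
        where
        term : Fin ne → Fin (suc k) → Carrier
        term e i = δ (edge i) e * sign i
        other : ∀ i e → e ≢ edge i → δ (edge i) e * sign i * f e ≈ 0#
        other i e e≢edge = ≈-trans (*-congʳ (δ-≢-* (e≢edge ∘ sym))) (zeroˡ (f e))

      signed-incidence : ∀ v i → sign i * incidence v (edge i) ≈ δ (vert i) (fsuc v) - δ (vert (next i)) (fsuc v)
      signed-incidence v i with G (edge i) | edge-join i
      ... | _ | inj₁ refl = *-identityˡ _
      ... | _ | inj₂ refl = ≈-trans (-1*x≈-x _) (⁻¹-anti-homo‿- _ _)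

      rows-vanish : ∀ v → sum (λ e → coefficient e * incidence v e) ≈ 0#
      rows-vanish v = begin
        sum (λ e → coefficient e * incidence v e)                     ≈⟨ ∑-coefficient (incidence v) ⟩
        sum (λ i → sign i * incidence v (edge i))                     ≈⟨ sum-cong-≋ (signed-incidence v) ⟩
        sum (λ i → δ (vert i) (fsuc v) - δ (vert (next i)) (fsuc v))  ≈⟨ ∑-cyclic-difference (λ i → δ (vert i) (fsuc v)) ⟩
        0#                                                            ∎

      cycle⇒dependent : ¬ (0# ≈ 1#) → ¬ ColumnsIndep R incidence X
      cycle⇒dependent 0≉1 independent = ±1≉0 0≉1 (sign-±1 fzero) (begin
        sign fzero                ≈⟨ ≈-sym (coefficient-edge fzero) ⟩
        coefficient (edge fzero)  ≈⟨ independent coefficient coefficient-outside rows-vanish (edge fzero) (edge-in fzero) ⟩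
        0#                        ∎)

    incidence-represents : ¬ (0# ≈ 1#) → (∀ {X} → CycleIndep G X → Prunable G X) →
                           RepresentableOver R (CycleIndep G)
    incidence-represents 0≉1 acyclic⇒prunable =
      m , incidence , λ X → prunable⇒independent ∘ acyclic⇒prunable , λ independent c → cycle⇒dependent c 0≉1 independent

-- Independence of the columns over ℤ excludes cycles.
prunable⇒acyclic : ∀ {m ne} {G : Graph (suc m) ne} {X} → Prunable G X → CycleIndep G X
prunable⇒acyclic {G = G} p c = cycle⇒dependent G c (λ ()) (prunable⇒independent G p)
  where open IncidenceMatrix ℤ.+-*-commutativeRing

-- Opened only here, below IncidenceMatrix, whose ring operations share these names.
open import Data.Nat using (_+_; _*_; _∸_)

-- Counting, maxima and sorting

∣Empty∣≡0 : ∀ {n} {p : Subset n} → Empty p → ∣ p ∣ ≡ 0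
∣Empty∣≡0 {n} p-empty = trans (cong ∣_∣ (Empty-unique p-empty)) (∣⊥∣≡0 n)

∣p∣+∣q∣≡∣p∪q∣+∣p∩q∣ : ∀ {n} (p q : Subset n) → ∣ p ∣ + ∣ q ∣ ≡ ∣ p ∪ q ∣ + ∣ p ∩ q ∣
∣p∣+∣q∣≡∣p∪q∣+∣p∩q∣ []            []            = refl
∣p∣+∣q∣≡∣p∪q∣+∣p∩q∣ (inside ∷ p)  (inside ∷ q)  =
  cong suc (trans (ℕP.+-suc _ _) (trans (cong suc (∣p∣+∣q∣≡∣p∪q∣+∣p∩q∣ p q)) (sym (ℕP.+-suc _ _))))
∣p∣+∣q∣≡∣p∪q∣+∣p∩q∣ (inside ∷ p)  (outside ∷ q) = cong suc (∣p∣+∣q∣≡∣p∪q∣+∣p∩q∣ p q)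
∣p∣+∣q∣≡∣p∪q∣+∣p∩q∣ (outside ∷ p) (inside ∷ q)  = trans (ℕP.+-suc _ _) (cong suc (∣p∣+∣q∣≡∣p∪q∣+∣p∩q∣ p q))
∣p∣+∣q∣≡∣p∪q∣+∣p∩q∣ (outside ∷ p) (outside ∷ q) = ∣p∣+∣q∣≡∣p∪q∣+∣p∩q∣ p q

∣p∪q∣≤∣p∣+∣q∣ : ∀ {n} (p q : Subset n) → ∣ p ∪ q ∣ ≤ ∣ p ∣ + ∣ q ∣
∣p∪q∣≤∣p∣+∣q∣ p q = ℕP.≤-trans (ℕP.m≤m+n _ _) (ℕP.≤-reflexive (sym (∣p∣+∣q∣≡∣p∪q∣+∣p∩q∣ p q)))

∣p∣≤∣p-x∣+1 : ∀ {n} (p : Subset n) x → ∣ p ∣ ≤ ∣ p ∖ x ∣ + 1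
∣p∣≤∣p-x∣+1 p x = begin
  ∣ p ∣                  ≤⟨ p⊆q⇒∣p∣≤∣q∣ p⊆p-x∪x ⟩
  ∣ (p ∖ x) ∪ ⁅ x ⁆ ∣    ≤⟨ ∣p∪q∣≤∣p∣+∣q∣ (p ∖ x) ⁅ x ⁆ ⟩
  ∣ p ∖ x ∣ + ∣ ⁅ x ⁆ ∣  ≡⟨ cong (∣ p ∖ x ∣ +_) (∣⁅x⁆∣≡1 x) ⟩
  ∣ p ∖ x ∣ + 1          ∎
  where
  open ℕP.≤-Reasoning
  p⊆p-x∪x : p ⊆ (p ∖ x) ∪ ⁅ x ⁆
  p⊆p-x∪x {y} y∈p with y ≟ x
  ... | yes refl = x∈p∪q⁺ (inj₂ (x∈⁅x⁆ y))
  ... | no  y≢x  = x∈p∪q⁺ (inj₁ (x∈p∧x≢y⇒x∈p-y y∈p y≢x))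

subsingleton⇒∣p∣≤1 : ∀ {n} (p : Subset n) → (∀ {x y} → x ∈ p → y ∈ p → x ≡ y) → ∣ p ∣ ≤ 1
subsingleton⇒∣p∣≤1 []            _      = z≤n
subsingleton⇒∣p∣≤1 (inside ∷ p)  unique =
  s≤s (ℕP.≤-reflexive (∣Empty∣≡0 (λ (x , x∈p) → FinP.0≢1+n (unique here (there x∈p)))))
subsingleton⇒∣p∣≤1 (outside ∷ p) unique =
  subsingleton⇒∣p∣≤1 p (λ x∈p y∈p → FinP.suc-injective (unique (there x∈p) (there y∈p)))

injection⇒≤∣p∣ : ∀ {k n} {p : Subset n} (f : Fin k → Fin n) → Injective _≡_ _≡_ f → (∀ i → f i ∈ p) →
                 k ≤ ∣ p ∣
injection⇒≤∣p∣ {zero}          _ _           _     = z≤n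
injection⇒≤∣p∣ {suc k} {p = p} f f-injective f∈p =
  ℕP.<-≤-trans (s≤s (injection⇒≤∣p∣ (f ∘ fsuc) (FinP.suc-injective ∘ f-injective) f∘suc∈p-f0))
               (x∈p⇒∣p-x∣<∣p∣ (f∈p fzero))
  where
  f∘suc∈p-f0 : ∀ i → f (fsuc i) ∈ p ∖ f fzero
  f∘suc∈p-f0 i = x∈p∧x≢y⇒x∈p-y (f∈p (fsuc i)) (FinP.0≢1+n ∘ sym ∘ f-injective)

∣prunable∣≤∣cover∣ : ∀ {m ne} {G : Graph (suc m) ne} {X} → Prunable G X → (S : Subset m) →
                     (∀ {e v} → e ∈ X → Incident G e (fsuc v) → v ∈ S) → ∣ X ∣ ≤ ∣ S ∣
∣prunable∣≤∣cover∣ (empty X-empty) _ _ = ℕP.≤-trans (ℕP.≤-reflexive (∣Empty∣≡0 X-empty)) z≤n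
∣prunable∣≤∣cover∣ {G = G} {X} (prune p rest) S covers = begin
  ∣ X ∣                  ≤⟨ ∣p∣≤∣p-x∣+1 X edge ⟩
  ∣ X ∖ edge ∣ + 1       ≤⟨ ℕP.+-monoˡ-≤ 1 (∣prunable∣≤∣cover∣ rest (S ∖ vertex) covers′) ⟩
  ∣ S ∖ vertex ∣ + 1     ≡⟨ ℕP.+-comm _ 1 ⟩
  suc ∣ S ∖ vertex ∣     ≤⟨ x∈p⇒∣p-x∣<∣p∣ (covers edge∈X (link⇒incident G link)) ⟩
  ∣ S ∣                  ∎
  where
  open ℕP.≤-Reasoning
  open Pendant p
  covers′ : ∀ {e v} → e ∈ X ∖ edge → Incident G e (fsuc v) → v ∈ S ∖ vertex
  covers′ {e} e∈ inc = x∈p∧x≢y⇒x∈p-y (covers e∈X′ inc) (λ { refl → alone e∈X′ e≢edge inc })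
    where
    e∈X′ : e ∈ X
    e∈X′ = p─q⊆p X ⁅ edge ⁆ e∈
    e≢edge : e ≢ edge
    e≢edge refl = x∈p─q⇒x∉q X ⁅ edge ⁆ e∈ (x∈⁅x⁆ edge)

1+2n≤2[1+n] : ∀ n → suc (2 * n) ≤ 2 * suc n
1+2n≤2[1+n] n = ℕP.≤-trans (ℕP.n≤1+n _) (ℕP.≤-reflexive (sym (ℕP.*-suc 2 n)))

maximum-by : ∀ {n} {p : Subset n} (f : Fin n → ℕ) → Nonempty p → ∃ λ x → x ∈ p × (∀ {y} → y ∈ p → f y ≤ f x)
maximum-by {n} {p} f (x₀ , x₀∈p) =
  argmax f x₀ candidates ,
  argmax-all f x₀∈p (all-filter (_∈? p) (allFin n)) ,
  λ y∈p → All.lookup (f[xs]≤f[argmax] x₀ candidates) (∈-filter⁺ (_∈? p) (∈-allFin _) y∈p)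
  where
  candidates : List (Fin n)
  candidates = filter (_∈? p) (allFin n)

maximal-run-before : ∀ {P : ℕ → Set} → (∀ j → Dec (P j)) → ∀ b →
                     ∃ λ a → a ≤ b × (∀ {j} → a ≤ j → j < b → P j) × (∀ {a′} → a ≡ suc a′ → ¬ P a′)
maximal-run-before P? zero = 0 , z≤n , (λ _ ()) , λ ()
maximal-run-before P? (suc b) with P? b
... | no ¬Pb = suc b , ℕP.≤-refl , (λ a≤j j<a → ⊥-elim (ℕP.<⇒≱ j<a a≤j)) , λ { refl → ¬Pb }
... | yes Pb with maximal-run-before P? b
...   | a , a≤b , run , start = a , ℕP.m≤n⇒m≤1+n a≤b , run′ , start
  where
  run′ : ∀ {j} → a ≤ j → j < suc b → _
  run′ a≤j j<1+b with ℕP.m<1+n⇒m<n∨m≡n j<1+b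
  ... | inj₁ j<b  = run a≤j j<b
  ... | inj₂ refl = Pb

injective⇒surjective : ∀ {n} (f : Fin n → Fin n) → Injective _≡_ _≡_ f → ∀ y → ∃ λ x → f x ≡ y
injective⇒surjective {suc n} f f-injective y with FinP.any? (λ x → f x ≟ y)
... | yes hit = hit
... | no  miss = ⊥-elim (ℕP.1+n≰n (FinP.injective⇒≤ g-injective))
  where
  g : Fin (suc n) → Fin n
  g x = Data.Fin.punchOut {i = y} {j = f x} (λ y≡fx → miss (x , sym y≡fx))
  g-injective : Injective _≡_ _≡_ g
  g-injective {x} {x′} eq =
    f-injective (FinP.punchOut-injective (λ y≡fx → miss (x , sym y≡fx)) (λ y≡fx′ → miss (x′ , sym y≡fx′)) eq)

module _ {n} (key : Fin n → ℕ) where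

  private
    tiebroken : Fin n → ℕ
    tiebroken e = key e * n + toℕ e

    tiebroken-mono : ∀ {e e′} → key e < key e′ → tiebroken e < tiebroken e′
    tiebroken-mono {e} {e′} key-e<key-e′ = begin-strict
      key e * n + toℕ e    <⟨ ℕP.+-monoʳ-< (key e * n) (FinP.toℕ<n e) ⟩
      key e * n + n        ≡⟨ ℕP.+-comm (key e * n) n ⟩
      suc (key e) * n      ≤⟨ ℕP.*-monoˡ-≤ n key-e<key-e′ ⟩
      key e′ * n           ≤⟨ ℕP.m≤m+n (key e′ * n) (toℕ e′) ⟩
      key e′ * n + toℕ e′  ∎
      where open ℕP.≤-Reasoning

    tiebroken-injective : Injective _≡_ _≡_ tiebroken
    tiebroken-injective {e} {e′} eq with ℕP.<-cmp (key e) (key e′)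
    ... | tri< lt _ _ = ⊥-elim (ℕP.<-irrefl eq (tiebroken-mono lt))
    ... | tri> _ _ gt = ⊥-elim (ℕP.<-irrefl (sym eq) (tiebroken-mono gt))
    ... | tri≈ _ same _ = FinP.toℕ-injective (ℕP.+-cancelˡ-≡ (key e * n) _ _ eq′)
      where
      eq′ : key e * n + toℕ e ≡ key e * n + toℕ e′
      eq′ = subst (λ k → key e * n + toℕ e ≡ k * n + toℕ e′) (sym same) eq

    below : Fin n → Subset n
    below e = toSubset (λ e′ → tiebroken e′ <? tiebroken e)

    ∈below⁺ : ∀ {e e′} → tiebroken e′ < tiebroken e → e′ ∈ below e
    ∈below⁺ = ∈toSubset⁺

    ∈below⁻ : ∀ {e e′} → e′ ∈ below e → tiebroken e′ < tiebroken e
    ∈below⁻ {e} = ∈toSubset⁻ {P? = λ e′ → tiebroken e′ <? tiebroken e}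

    rank : Fin n → ℕ
    rank e = ∣ below e ∣

    rank-mono : ∀ {e e′} → tiebroken e′ < tiebroken e → rank e′ < rank e
    rank-mono {e} {e′} e′<e = p⊂q⇒∣p∣<∣q∣
      ( (λ e″∈ → ∈below⁺ (ℕP.<-trans (∈below⁻ e″∈) e′<e))
      , e′ , ∈below⁺ e′<e , λ e′∈ → ℕP.<-irrefl refl (∈below⁻ e′∈) )

    rank<n : ∀ e → rank e < n
    rank<n e = subst (rank e <_) (∣⊤∣≡n n)
      (p⊂q⇒∣p∣<∣q∣ ((λ _ → ∈⊤) , e , ∈⊤ , λ e∈ → ℕP.<-irrefl refl (∈below⁻ e∈)))

    position : Fin n → Fin n
    position e = fromℕ< (rank<n e)

    toℕ-position : ∀ e → toℕ (position e) ≡ rank e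
    toℕ-position e = FinP.toℕ-fromℕ< (rank<n e)

    position-injective : Injective _≡_ _≡_ position
    position-injective {e} {e′} eq = tiebroken-injective (ℕP.≤-antisym
      (ℕP.≮⇒≥ (λ e′<e → ℕP.<-irrefl (sym same-rank) (rank-mono e′<e)))
      (ℕP.≮⇒≥ (λ e<e′ → ℕP.<-irrefl same-rank (rank-mono e<e′))))
      where
      same-rank : rank e ≡ rank e′
      same-rank = trans (sym (toℕ-position e)) (trans (cong toℕ eq) (toℕ-position e′))

    element : Fin n → Fin n
    element i = proj₁ (injective⇒surjective position position-injective i)

  sorting-permutation : Σ (Permutation′ n) λ σ →
                        ∀ {e e′} → key e < key e′ → toℕ (σ ⟨$⟩ˡ e) < toℕ (σ ⟨$⟩ˡ e′)
  sorting-permutation =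
    permutation element position
      (λ e → position-injective (proj₂ (injective⇒surjective position position-injective (position e))))
      (λ i → proj₂ (injective⇒surjective position position-injective i)) ,
    λ {e} {e′} lt → subst₂ _<_ (sym (toℕ-position e)) (sym (toℕ-position e′)) (rank-mono (tiebroken-mono lt))

prefix-initial : ∀ {n} {key : Fin n → ℕ} (σ : Permutation′ n) →
                 (∀ {e e′} → key e < key e′ → toℕ (σ ⟨$⟩ˡ e) < toℕ (σ ⟨$⟩ˡ e′)) →
                 ∀ i {e e′} → e ∈ prefix σ i → e′ ∉ prefix σ i → key e ≤ key e′
prefix-initial σ sorted i {e} {e′} e∈ e′∉ =
  ℕP.≮⇒≥ (λ e′<e → e′∉ (∈-tabulate⁺ (ℕP.<⇒<ᵇ (ℕP.<-trans (sorted e′<e) e<i))))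
  where
  e<i : toℕ (σ ⟨$⟩ˡ e) < i
  e<i = ℕP.<ᵇ⇒< (toℕ (σ ⟨$⟩ˡ e)) i (∈-tabulate⁻ e∈)

-- Umbrellas

module Umbrella {m ne : ℕ} {H : Graph (suc m) ne} (U : IsUmbrella H) where

  open IsUmbrella U

  -- The vertex u_j for j ≤ m; u (suc m) wraps around to u₀.
  u : ℕ → Fin (suc m)
  u j = j mod suc m

  u-injective : ∀ {i j} → i ≤ m → j ≤ m → u i ≡ u j → i ≡ j
  u-injective i≤m j≤m eq = trans (sym (toℕ-mod i≤m)) (trans (cong toℕ eq) (toℕ-mod j≤m))

  u-suc≢0 : ∀ {j} → j < m → u (suc j) ≢ fzero
  u-suc≢0 j<m eq = ℕP.1+n≢0 (trans (sym (toℕ-mod j<m)) (cong toℕ eq))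

  u≢u-suc : ∀ {j} → j < m → u j ≢ u (suc j)
  u≢u-suc j<m eq = ℕP.1+n≢n (sym (u-injective (ℕP.<⇒≤ j<m) j<m eq))

  fsuc≡u : ∀ (v : Fin m) → fsuc v ≡ u (suc (toℕ v))
  fsuc≡u v = FinP.toℕ-injective (sym (toℕ-mod (FinP.toℕ<n v)))

  fsuc≡u-suc : ∀ {j} (j<m : j < m) → fsuc (fromℕ< j<m) ≡ u (suc j)
  fsuc≡u-suc j<m = trans (fsuc≡u (fromℕ< j<m)) (cong (u ∘ suc) (FinP.toℕ-fromℕ< j<m))

  u-wrap : ∀ {j} → j ≡ m → u (suc j) ≡ fzero
  u-wrap {j} j≡m = subst (λ k → suc j mod suc k ≡ fzero) j≡m (mod-self j)

  rim-joins : ∀ {j} → j ≤ m → Joins H (circ (u j)) (u j) (u (suc j))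
  rim-joins {j} j≤m = subst (Joins H (circ (u j)) (u j)) (cong (λ k → suc k mod suc m) (toℕ-mod j≤m)) (circ-join (u j))

  data Kind (e : Fin ne) : Set where
    spoke : ∀ j → j < m → Joins H e fzero (u (suc j)) → Kind e
    rim   : ∀ j → 0 < j → j < m → circ (u j) ≡ e → Kind e
    loop  : m ≡ 0 → Joins H e fzero fzero → Kind e

  circ-kind : ∀ j → j ≤ m → Kind (circ (u j))
  circ-kind zero _ with m ℕP.≟ 0
  ... | yes m≡0 = loop m≡0 (subst (Joins H _ fzero) (u-wrap (sym m≡0)) (rim-joins z≤n))
  ... | no  m≢0 = spoke 0 (ℕP.n≢0⇒n>0 m≢0) (rim-joins z≤n)
  circ-kind (suc j) 1+j≤m with ℕP.m≤n⇒m<n∨m≡n 1+j≤m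
  ... | inj₁ 1+j<m = rim (suc j) z<s 1+j<m refl
  ... | inj₂ 1+j≡m = spoke j 1+j≤m (joins-sym H (subst (Joins H _ (u (suc j))) (u-wrap 1+j≡m) (rim-joins 1+j≤m)))

  kind : ∀ e → Kind e
  kind e with FinP.any? (λ i → circ i ≟ e)
  ... | yes (i , refl) = subst (Kind ∘ circ) (mod-toℕ i) (circ-kind (toℕ i) (FinP.toℕ≤pred[n] i))
  ... | no  ¬circ      = from-spoke (spokes e (λ i eq → ¬circ (i , eq)))
    where
    from-spoke : Σ (Fin m) (λ v → Joins H e fzero (fsuc v)) → Kind e
    from-spoke (v , J) = spoke (toℕ v) (FinP.toℕ<n v) (subst (Joins H e fzero) (fsuc≡u v) J)

  -- The edge order: the spokes at u_{j+1} get slot 2(j+1) and the rim edge u_j u_{j+1}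
  -- gets 2j+1, so the edges at u_{j+1} fill the slots 2j+1, 2j+2, 2j+3.
  slot-of : ∀ {e} → Kind e → ℕ
  slot-of (spoke j _ _) = 2 * suc j
  slot-of (rim j _ _ _) = suc (2 * j)
  slot-of (loop _ _)    = 0

  slot : Fin ne → ℕ
  slot e = slot-of (kind e)

  rim-not-spoke : ∀ {e j v} → 0 < j → j < m → circ (u j) ≡ e → ¬ Joins H e fzero v
  rim-not-spoke {j = suc i} _ j<m refl J with joins-ends H (rim-joins (ℕP.<⇒≤ j<m)) J
  ... | inj₁ (uj≡0 , _)  = u-suc≢0 (ℕP.<-trans (ℕP.n<1+n i) j<m) uj≡0
  ... | inj₂ (_ , uj+1≡0) = u-suc≢0 j<m uj+1≡0

  spoke-end-unique : ∀ {e i j} → i < m → j < m → Joins H e fzero (u (suc i)) → Joins H e fzero (u (suc j)) → i ≡ j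
  spoke-end-unique i<m j<m J J′ with joins-ends H J J′
  ... | inj₁ (_ , eq)   = ℕP.suc-injective (u-injective i<m j<m eq)
  ... | inj₂ (0≡u , _)  = ⊥-elim (u-suc≢0 j<m (sym 0≡u))

  slot-spoke : ∀ {e j} → j < m → Joins H e fzero (u (suc j)) → slot e ≡ 2 * suc j
  slot-spoke {e} j<m J with kind e
  ... | spoke i i<m J′   = cong (λ k → 2 * suc k) (spoke-end-unique i<m j<m J′ J)
  ... | rim _ 0<i i<m eq = ⊥-elim (rim-not-spoke 0<i i<m eq J)
  ... | loop m≡0 _       = ⊥-elim (ℕP.n≮0 (subst (_ <_) m≡0 j<m))

  slot-rim : ∀ {e j} → 0 < j → j < m → circ (u j) ≡ e → slot e ≡ suc (2 * j)
  slot-rim {e} 0<j j<m eq with kind e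
  ... | spoke _ _ J       = ⊥-elim (rim-not-spoke 0<j j<m eq J)
  ... | rim i _ i<m eq′   =
    cong (λ k → suc (2 * k)) (u-injective (ℕP.<⇒≤ i<m) (ℕP.<⇒≤ j<m) (circ-inj (trans eq′ (sym eq))))
  ... | loop m≡0 _        = ⊥-elim (ℕP.n≮0 (subst (_ <_) m≡0 j<m))

  odd-slot⇒rim : ∀ {e j} → slot e ≡ suc (2 * j) → circ (u j) ≡ e
  odd-slot⇒rim {e} {j} eq with kind e
  ... | spoke i _ _    = ⊥-elim (ℕP.even≢odd (suc i) j eq)
  ... | rim i _ _ eq′  = subst (λ k → circ (u k) ≡ e) (ℕP.*-cancelˡ-≡ i j 2 (ℕP.suc-injective eq)) eq′
  ... | loop _ _       = ⊥-elim (ℕP.0≢1+n eq)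

  odd-slot-injective : ∀ {e e′ j} → slot e ≡ suc (2 * j) → slot e′ ≡ suc (2 * j) → e ≡ e′
  odd-slot-injective {j = j} eq eq′ = trans (sym (odd-slot⇒rim {j = j} eq)) (odd-slot⇒rim {j = j} eq′)

  data IncidenceAt (e : Fin ne) (r : ℕ) : Set where
    spoke-at  : Joins H e fzero (u (suc r)) → IncidenceAt e r
    rim-above : suc r < m → circ (u (suc r)) ≡ e → IncidenceAt e r
    rim-below : 0 < r → circ (u r) ≡ e → IncidenceAt e r

  incidence-at : ∀ {e r} → r < m → Incident H e (u (suc r)) → IncidenceAt e r
  incidence-at {e} {r} r<m inc = from-kind (kind e)
    where
    from-kind : Kind e → IncidenceAt e r
    from-kind (spoke j j<m J) with joins-incident H J inc
    ... | inj₁ u≡0 = ⊥-elim (u-suc≢0 r<m u≡0)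
    ... | inj₂ u≡u = spoke-at (subst (Joins H e fzero) (sym u≡u) J)
    from-kind (rim j 0<j j<m eq) with joins-incident H (subst (λ e′ → Joins H e′ _ _) eq (rim-joins (ℕP.<⇒≤ j<m))) inc
    ... | inj₁ u≡u = let r+1≡j = u-injective r<m (ℕP.<⇒≤ j<m) u≡u in
                     rim-above (subst (_< m) (sym r+1≡j) j<m) (subst (λ k → circ (u k) ≡ e) (sym r+1≡j) eq)
    ... | inj₂ u≡u = let r≡j = ℕP.suc-injective (u-injective r<m j<m u≡u) in
                     rim-below (subst (0 <_) (sym r≡j) 0<j) (subst (λ k → circ (u k) ≡ e) (sym r≡j) eq)
    from-kind (loop _ J) with joins-incident H J inc
    ... | inj₁ u≡0 = ⊥-elim (u-suc≢0 r<m u≡0)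
    ... | inj₂ u≡0 = ⊥-elim (u-suc≢0 r<m u≡0)

  slot-bounds : ∀ {e r} → r < m → IncidenceAt e r → suc (2 * r) ≤ slot e × slot e ≤ suc (2 * suc r)
  slot-bounds r<m (spoke-at J) rewrite slot-spoke r<m J = 1+2n≤2[1+n] _ , ℕP.n≤1+n _
  slot-bounds r<m (rim-above r+1<m eq) rewrite slot-rim z<s r+1<m eq =
    s≤s (ℕP.*-monoʳ-≤ 2 (ℕP.n≤1+n _)) , ℕP.≤-refl
  slot-bounds r<m (rim-below 0<r eq) rewrite slot-rim 0<r r<m eq =
    ℕP.≤-refl , s≤s (ℕP.*-monoʳ-≤ 2 (ℕP.n≤1+n _))

  loop-cycle : ∀ {X e} → e ∈ X → Joins H e fzero fzero → CycleIn H X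
  loop-cycle {e = e} e∈X J =
    cycle-from H 0 (λ _ → e) e (λ _ → fzero) (λ ()) e∈X (λ ()) J (λ ()) (λ ())
      (λ i≤0 j≤0 _ → trans (ℕP.n≤0⇒n≡0 i≤0) (sym (ℕP.n≤0⇒n≡0 j≤0)))

  fan : ∀ {X s b ρ₁ ρ₂} → suc s ≤ b → b ≤ m → ρ₁ ≢ ρ₂ → ρ₁ ∈ X → ρ₂ ∈ X →
        Joins H ρ₁ fzero (u (suc s)) → Joins H ρ₂ fzero (u b) →
        (∀ {j} → suc s ≤ j → j < b → circ (u j) ∈ X) → CycleIn H X
  fan {X} {s} {b} {ρ₁} {ρ₂} 1+s≤b b≤m ρ₁≢ρ₂ ρ₁∈X ρ₂∈X J₁ J₂ rims∈X =
    cycle-from H (suc d) E ρ₂ V E∈X ρ₂∈X E-joins closing E-injective E≢ρ₂ V-injective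
    where
    d : ℕ
    d = b ∸ suc s

    1+s+d≡b : suc s + d ≡ b
    1+s+d≡b = ℕP.m+[n∸m]≡n 1+s≤b

    1+s+j≤m : ∀ {j} → j ≤ d → suc s + j ≤ m
    1+s+j≤m j≤d = ℕP.≤-trans (subst (suc s + _ ≤_) 1+s+d≡b (ℕP.+-monoʳ-≤ (suc s) j≤d)) b≤m

    1+s+j<b : ∀ {j} → j < d → suc s + j < b
    1+s+j<b j<d = subst (suc s + _ <_) 1+s+d≡b (ℕP.+-monoʳ-< (suc s) j<d)

    E : ℕ → Fin ne
    E zero    = ρ₁
    E (suc j) = circ (u (suc s + j))

    V : ℕ → Fin (suc m)
    V zero    = fzero
    V (suc j) = u (suc s + j)

    E∈X : ∀ {i} → i < suc d → E i ∈ X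
    E∈X {zero}  _         = ρ₁∈X
    E∈X {suc j} (s≤s j<d) = rims∈X (ℕP.m≤m+n (suc s) j) (1+s+j<b j<d)

    E-joins : ∀ {i} → i < suc d → Joins H (E i) (V i) (V (suc i))
    E-joins {zero}  _         = subst (λ k → Joins H ρ₁ fzero (u (suc k))) (sym (ℕP.+-identityʳ s)) J₁
    E-joins {suc j} (s≤s j<d) =
      subst (Joins H (E (suc j)) (V (suc j))) (cong u (sym (ℕP.+-suc (suc s) j))) (rim-joins (1+s+j≤m (ℕP.<⇒≤ j<d)))

    closing : Joins H ρ₂ (V (suc d)) (V 0)
    closing = joins-sym H (subst (λ k → Joins H ρ₂ fzero (u k)) (sym 1+s+d≡b) J₂)

    rim-E : ∀ {j} → j < d → ∀ {v} → ¬ Joins H (E (suc j)) fzero v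
    rim-E j<d = rim-not-spoke z<s (ℕP.<-≤-trans (1+s+j<b j<d) b≤m) refl

    E-injective : ∀ {i j} → i < suc d → j < suc d → E i ≡ E j → i ≡ j
    E-injective {zero}  {zero}  _         _         _  = refl
    E-injective {zero}  {suc j} _         (s≤s j<d) eq = ⊥-elim (rim-E j<d (subst (λ e → Joins H e fzero _) eq J₁))
    E-injective {suc i} {zero}  (s≤s i<d) _         eq = ⊥-elim (rim-E i<d (subst (λ e → Joins H e fzero _) (sym eq) J₁))
    E-injective {suc i} {suc j} (s≤s i<d) (s≤s j<d) eq =
      cong suc (ℕP.+-cancelˡ-≡ (suc s) _ _ (u-injective (1+s+j≤m (ℕP.<⇒≤ i<d)) (1+s+j≤m (ℕP.<⇒≤ j<d)) (circ-inj eq)))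

    E≢ρ₂ : ∀ {i} → i < suc d → E i ≢ ρ₂
    E≢ρ₂ {zero}  _         = ρ₁≢ρ₂
    E≢ρ₂ {suc j} (s≤s j<d) eq = rim-E j<d (subst (λ e → Joins H e fzero _) (sym eq) J₂)

    V-injective : ∀ {i j} → i ≤ suc d → j ≤ suc d → V i ≡ V j → i ≡ j
    V-injective {zero}  {zero}  _         _         _  = refl
    V-injective {zero}  {suc j} _         (s≤s j≤d) eq = ⊥-elim (u-suc≢0 (1+s+j≤m j≤d) (sym eq))
    V-injective {suc i} {zero}  (s≤s i≤d) _         eq = ⊥-elim (u-suc≢0 (1+s+j≤m i≤d) eq)
    V-injective {suc i} {suc j} (s≤s i≤d) (s≤s j≤d) eq =
      cong suc (ℕP.+-cancelˡ-≡ (suc s) _ _ (u-injective (1+s+j≤m i≤d) (1+s+j≤m j≤d) eq))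

  pendant-at : ∀ {X e x r} (r<m : r < m) → e ∈ X → Joins H e x (u (suc r)) → x ≢ u (suc r) →
               (∀ {e′} → e′ ∈ X → e′ ≢ e → ¬ Incident H e′ (u (suc r))) → Pendant H X
  pendant-at {e = e} r<m e∈X J x≢ alone = record
    { edge   = e
    ; vertex = fromℕ< r<m
    ; edge∈X = e∈X
    ; link   = subst (IsLinkAt H e) (sym (fsuc≡u-suc r<m)) (joins-link H J x≢)
    ; alone  = λ e′∈X e′≢e inc → alone e′∈X e′≢e (subst (Incident H _) (fsuc≡u-suc r<m) inc)
    }

  top-rim-pendant : ∀ {X e j} → e ∈ X → (∀ {e′} → e′ ∈ X → slot e′ ≤ slot e) →
                    0 < j → j < m → circ (u j) ≡ e → Pendant H X
  top-rim-pendant {X} {e} {j} e∈X maximal 0<j j<m eq =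
    pendant-at j<m e∈X (subst (λ e′ → Joins H e′ _ _) eq (rim-joins (ℕP.<⇒≤ j<m))) (u≢u-suc j<m) alone
    where
    slot-e : slot e ≡ suc (2 * j)
    slot-e = slot-rim 0<j j<m eq
    alone : ∀ {e′} → e′ ∈ X → e′ ≢ e → ¬ Incident H e′ (u (suc j))
    alone {e′} e′∈X e′≢e inc = e′≢e (odd-slot-injective {j = j} slot-e′ slot-e)
      where
      slot-e′ : slot e′ ≡ suc (2 * j)
      slot-e′ = ℕP.≤-antisym (ℕP.≤-trans (maximal e′∈X) (ℕP.≤-reflexive slot-e))
                             (proj₁ (slot-bounds j<m (incidence-at j<m inc)))

  RimIn : Subset ne → ℕ → Set
  RimIn X j = 0 < j × circ (u j) ∈ X

  spoke-leaf : ∀ {X e t} → e ∈ X → (∀ {e′} → e′ ∈ X → slot e′ ≤ slot e) → t < m → Joins H e fzero (u (suc t)) →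
               (∀ {e′} → e′ ∈ X → e′ ≢ e → ¬ Joins H e′ fzero (u (suc t))) → ¬ RimIn X t → Pendant H X
  spoke-leaf {X} {e} {t} e∈X maximal t<m J no-spoke no-rim-below = pendant-at t<m e∈X J (u-suc≢0 t<m ∘ sym) alone
    where
    alone : ∀ {e′} → e′ ∈ X → e′ ≢ e → ¬ Incident H e′ (u (suc t))
    alone e′∈X e′≢e inc with incidence-at t<m inc
    ... | spoke-at J′        = no-spoke e′∈X e′≢e J′
    ... | rim-above t+1<m eq = ℕP.1+n≰n (subst₂ _≤_ (slot-rim z<s t+1<m eq) (slot-spoke t<m J) (maximal e′∈X))
    ... | rim-below 0<t eq   = no-rim-below (0<t , subst (_∈ X) (sym eq) e′∈X)

  rim-leaf : ∀ {X s} → suc s < m → circ (u (suc s)) ∈ X →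
             (∀ {e′} → e′ ∈ X → ¬ Joins H e′ fzero (u (suc s))) → ¬ RimIn X s → Pendant H X
  rim-leaf {X} {s} 1+s<m rim∈X no-spoke no-rim-below =
    pendant-at s<m rim∈X (joins-sym H (rim-joins s<m)) (u≢u-suc 1+s<m ∘ sym) alone
    where
    s<m : s < m
    s<m = ℕP.<-trans (ℕP.n<1+n s) 1+s<m
    alone : ∀ {e′} → e′ ∈ X → e′ ≢ circ (u (suc s)) → ¬ Incident H e′ (u (suc s))
    alone e′∈X e′≢rim inc with incidence-at s<m inc
    ... | spoke-at J′      = no-spoke e′∈X J′
    ... | rim-above _ eq   = e′≢rim (sym eq)
    ... | rim-below 0<s eq = no-rim-below (0<s , subst (_∈ X) (sym eq) e′∈X)

  -- Walk down the rim from u_{t+1} through edges of X to the first u_{s+1} whose rim edge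
  -- below is not in X. Another spoke of X at u_{s+1} would close a fan with e; without
  -- one, u_{s+1} is a leaf.
  top-spoke-pendant : ∀ {X e t} → CycleIndep H X → e ∈ X → (∀ {e′} → e′ ∈ X → slot e′ ≤ slot e) →
                      t < m → Joins H e fzero (u (suc t)) → Pendant H X
  top-spoke-pendant {X} {e} {t} acyclic e∈X maximal t<m J = from-run (maximal-run-before rim∈X? (suc t))
    where
    rim∈X? : ∀ j → Dec (RimIn X j)
    rim∈X? j = (0 <? j) ×-dec (circ (u j) ∈? X)

    MaximalRun : ℕ → Set
    MaximalRun a = a ≤ suc t × (∀ {j} → a ≤ j → j < suc t → RimIn X j) × (∀ {a′} → a ≡ suc a′ → ¬ RimIn X a′)

    other-spoke? : ∀ s → Dec (∃ λ e′ → e′ ∈ X × e′ ≢ e × Joins H e′ fzero (u (suc s)))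
    other-spoke? s = FinP.any? (λ e′ → (e′ ∈? X) ×-dec (¬? (e′ ≟ e) ×-dec joins? H e′ fzero (u (suc s))))

    from-run : ∃ MaximalRun → Pendant H X
    from-run (zero , _ , run , _) = ⊥-elim (ℕP.<-irrefl refl (proj₁ (run z≤n z<s)))
    from-run (suc s , 1+s≤1+t , run , start) with other-spoke? s | ℕP.m≤n⇒m<n∨m≡n 1+s≤1+t
    ... | yes (e′ , e′∈X , e′≢e , J′) | _ =
      ⊥-elim (acyclic (fan 1+s≤1+t t<m e′≢e e′∈X e∈X J′ J (λ 1+s≤j j<1+t → proj₂ (run 1+s≤j j<1+t))))
    ... | no no-spoke | inj₂ refl =
      spoke-leaf e∈X maximal t<m J (λ e′∈X e′≢e J′ → no-spoke (_ , e′∈X , e′≢e , J′)) (start refl)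
    ... | no no-spoke | inj₁ 1+s<1+t = rim-leaf 1+s<m (proj₂ (run ℕP.≤-refl 1+s<1+t)) no-spoke′ (start refl)
      where
      1+s<m : suc s < m
      1+s<m = ℕP.<-≤-trans 1+s<1+t t<m
      no-spoke′ : ∀ {e′} → e′ ∈ X → ¬ Joins H e′ fzero (u (suc s))
      no-spoke′ {e′} e′∈X J′ with e′ ≟ e
      ... | yes refl = ℕP.<-irrefl (cong suc (spoke-end-unique (ℕP.<-trans (ℕP.n<1+n s) 1+s<m) t<m J′ J)) 1+s<1+t
      ... | no  e′≢e = no-spoke (_ , e′∈X , e′≢e , J′)

  pendant : ∀ {X} → CycleIndep H X → Nonempty X → Pendant H X
  pendant {X} acyclic X-nonempty =
    let e , e∈X , maximal = maximum-by slot X-nonempty in top-pendant e∈X maximal (kind e)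
    where
    top-pendant : ∀ {e} → e ∈ X → (∀ {e′} → e′ ∈ X → slot e′ ≤ slot e) → Kind e → Pendant H X
    top-pendant e∈X maximal (spoke t t<m J)    = top-spoke-pendant acyclic e∈X maximal t<m J
    top-pendant e∈X maximal (rim j 0<j j<m eq) = top-rim-pendant e∈X maximal 0<j j<m eq
    top-pendant e∈X _       (loop _ J)         = ⊥-elim (acyclic (loop-cycle e∈X J))

  acyclic⇒prunable : ∀ {X} → CycleIndep H X → Prunable H X
  acyclic⇒prunable acyclic = pendants⇒prunable H (λ Y⊆X → pendant (acyclic ∘ cycle-mono H Y⊆X))

  path : Subset ne
  path = toSubset (λ e → FinP.any? (λ (j : Fin m) → circ (u (toℕ j)) ≟ e))

  ∈path⁻ : ∀ {e} → e ∈ path → ∃ λ (j : Fin m) → circ (u (toℕ j)) ≡ e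
  ∈path⁻ = ∈toSubset⁻ {P? = λ e → FinP.any? (λ (j : Fin m) → circ (u (toℕ j)) ≟ e)}

  m≤∣path∣ : m ≤ ∣ path ∣
  m≤∣path∣ = injection⇒≤∣p∣ {p = path} (λ j → circ (u (toℕ j))) circ∘u-injective (λ j → ∈toSubset⁺ (j , refl))
    where
    circ∘u-injective : Injective _≡_ _≡_ (λ (j : Fin m) → circ (u (toℕ j)))
    circ∘u-injective eq = FinP.toℕ-injective (u-injective (ℕP.<⇒≤ (FinP.toℕ<n _)) (ℕP.<⇒≤ (FinP.toℕ<n _)) (circ-inj eq))

  slot-circ≤ : ∀ {j} → j < m → slot (circ (u j)) ≤ 2 * suc j
  slot-circ≤ {zero}  0<m   = ℕP.≤-reflexive (slot-spoke 0<m (rim-joins z≤n))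
  slot-circ≤ {suc j} 1+j<m = ℕP.≤-trans (ℕP.≤-reflexive (slot-rim z<s 1+j<m refl)) (1+2n≤2[1+n] (suc j))

  path-pendant : ∀ {Y} → Y ⊆ path → Nonempty Y → Pendant H Y
  path-pendant {Y} Y⊆path Y-nonempty =
    let e , e∈Y , maximal = maximum-by slot Y-nonempty in top-pendant e∈Y maximal (∈path⁻ (Y⊆path e∈Y))
    where
    top-pendant : ∀ {e} → e ∈ Y → (∀ {e′} → e′ ∈ Y → slot e′ ≤ slot e) →
                  (∃ λ (j : Fin m) → circ (u (toℕ j)) ≡ e) → Pendant H Y
    top-pendant e∈Y maximal (j , refl) = pendant-at j<m e∈Y (rim-joins (ℕP.<⇒≤ j<m)) (u≢u-suc j<m) alone
      where
      j<m : toℕ j < m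
      j<m = FinP.toℕ<n j
      alone : ∀ {e′} → e′ ∈ Y → e′ ≢ circ (u (toℕ j)) → ¬ Incident H e′ (u (suc (toℕ j)))
      alone e′∈Y e′≢e inc with ∈path⁻ (Y⊆path e′∈Y)
      ... | j′ , refl with joins-incident H (rim-joins (ℕP.<⇒≤ (FinP.toℕ<n j′))) inc
      ...   | inj₂ u≡u = e′≢e (cong (circ ∘ u) (sym (ℕP.suc-injective (u-injective j<m (FinP.toℕ<n j′) u≡u))))
      ...   | inj₁ u≡u = ℕP.1+n≰n (begin
        suc (2 * suc (toℕ j))   ≡⟨ cong (λ k → suc (2 * k)) j+1≡j′ ⟩
        suc (2 * toℕ j′)        ≡⟨ sym (slot-rim (subst (0 <_) j+1≡j′ z<s) (FinP.toℕ<n j′) refl) ⟩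
        slot (circ (u (toℕ j′))) ≤⟨ maximal e′∈Y ⟩
        slot (circ (u (toℕ j)))  ≤⟨ slot-circ≤ j<m ⟩
        2 * suc (toℕ j)          ∎)
        where
        open ℕP.≤-Reasoning
        j+1≡j′ : suc (toℕ j) ≡ toℕ j′
        j+1≡j′ = u-injective j<m (ℕP.<⇒≤ (FinP.toℕ<n j′)) u≡u

  path-acyclic : CycleIndep H path
  path-acyclic = prunable⇒acyclic (pendants⇒prunable H path-pendant)

  touched : Subset ne → Subset m
  touched X = toSubset (λ v → FinP.any? (λ e → (e ∈? X) ×-dec incident? H e (fsuc v)))

  ∈touched⁻ : ∀ {X v} → v ∈ touched X → ∃ λ e → e ∈ X × Incident H e (fsuc v)
  ∈touched⁻ {X} = ∈toSubset⁻ {P? = λ v → FinP.any? (λ e → (e ∈? X) ×-dec incident? H e (fsuc v))}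

  ∣acyclic∣≤∣touched∣ : ∀ {X Y} → Y ⊆ X → CycleIndep H Y → ∣ Y ∣ ≤ ∣ touched X ∣
  ∣acyclic∣≤∣touched∣ {X} Y⊆X acyclic =
    ∣prunable∣≤∣cover∣ (acyclic⇒prunable acyclic) (touched X) (λ e∈Y inc → ∈toSubset⁺ (_ , Y⊆X e∈Y , inc))

  module _ {X} (initial : ∀ {e e′} → e ∈ X → e′ ∉ X → slot e ≤ slot e′) where

    -- The two witnessing edges would share the odd slot 2v′+1, which only one rim edge has.
    no-crossing : ∀ {v v′} → v′ ∈ touched X → v ∈ touched (∁ X) → ¬ toℕ v < toℕ v′
    no-crossing {v} {v′} v′∈ v∈ v<v′ with ∈touched⁻ v′∈ | ∈touched⁻ v∈
    ... | e , e∈X , inc | e′ , e′∈∁X , inc′ =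
      x∈∁p⇒x∉p e′∈∁X (subst (_∈ X) (odd-slot-injective {j = toℕ v′} slot-e slot-e′) e∈X)
      where
      near : ∀ {f} (w : Fin m) → Incident H f (fsuc w) → suc (2 * toℕ w) ≤ slot f × slot f ≤ suc (2 * suc (toℕ w))
      near w inc = slot-bounds (FinP.toℕ<n w) (incidence-at (FinP.toℕ<n w) (subst (Incident H _) (fsuc≡u w) inc))
      lower : suc (2 * toℕ v′) ≤ slot e
      lower = proj₁ (near v′ inc)
      middle : slot e ≤ slot e′
      middle = initial e∈X (x∈∁p⇒x∉p e′∈∁X)
      upper : slot e′ ≤ suc (2 * toℕ v′)
      upper = ℕP.≤-trans (proj₂ (near v inc′)) (s≤s (ℕP.*-monoʳ-≤ 2 v<v′))
      slot-e : slot e ≡ suc (2 * toℕ v′)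
      slot-e = ℕP.≤-antisym (ℕP.≤-trans middle upper) lower
      slot-e′ : slot e′ ≡ suc (2 * toℕ v′)
      slot-e′ = ℕP.≤-antisym upper (ℕP.≤-trans lower middle)

    touched-overlap : ∀ {v v′} → v ∈ touched X ∩ touched (∁ X) → v′ ∈ touched X ∩ touched (∁ X) → v ≡ v′
    touched-overlap {v} {v′} v∈ v′∈ with x∈p∩q⁻ _ _ v∈ | x∈p∩q⁻ _ _ v′∈ | ℕP.<-cmp (toℕ v) (toℕ v′)
    ... | _ , v∈∁X  | v′∈X , _   | tri< v<v′ _ _ = ⊥-elim (no-crossing v′∈X v∈∁X v<v′)
    ... | _         | _          | tri≈ _ eq _   = FinP.toℕ-injective eq
    ... | v∈X , _   | _ , v′∈∁X  | tri> _ _ v′<v = ⊥-elim (no-crossing v∈X v′∈∁X v′<v)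

    ∣touched∣+∣touched∁∣≤m+1 : ∣ touched X ∣ + ∣ touched (∁ X) ∣ ≤ m + 1
    ∣touched∣+∣touched∁∣≤m+1 = begin
      ∣ touched X ∣ + ∣ touched (∁ X) ∣  ≡⟨ ∣p∣+∣q∣≡∣p∪q∣+∣p∩q∣ (touched X) (touched (∁ X)) ⟩
      ∣ union ∣ + ∣ common ∣             ≤⟨ ℕP.+-mono-≤ (∣p∣≤n union) (subsingleton⇒∣p∣≤1 common touched-overlap) ⟩
      m + 1                              ∎
      where
      open ℕP.≤-Reasoning
      union common : Subset m
      union  = touched X ∪ touched (∁ X)
      common = touched X ∩ touched (∁ X)

    width≤1 : ConnAtMost (CycleIndep H) X 1
    width≤1 _ _ c ((Y₁ , Y₁⊆X , Y₁-acyclic , refl) , _) ((Y₂ , Y₂⊆∁X , Y₂-acyclic , refl) , _) (_ , maximal) = begin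
      ∣ Y₁ ∣ + ∣ Y₂ ∣                    ≤⟨ ℕP.+-mono-≤ (∣acyclic∣≤∣touched∣ Y₁⊆X Y₁-acyclic)
                                                        (∣acyclic∣≤∣touched∣ Y₂⊆∁X Y₂-acyclic) ⟩
      ∣ touched X ∣ + ∣ touched (∁ X) ∣  ≤⟨ ∣touched∣+∣touched∁∣≤m+1 ⟩
      m + 1                              ≤⟨ ℕP.+-monoˡ-≤ 1 (ℕP.≤-trans m≤∣path∣ (maximal path (λ _ → ∈⊤) path-acyclic)) ⟩
      c + 1                              ∎
      where open ℕP.≤-Reasoning

  pathwidth≤1 : PathwidthAtMost (CycleIndep H) 1
  pathwidth≤1 = let σ , sorted = sorting-permutation slot in σ , λ i _ → width≤1 (prefix-initial σ sorted i)

lemma4p5 : (q : ℕ) → IsPrimePower q → (F : FiniteField q) →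
           (m ne : ℕ) → (H : Graph (suc m) ne) → IsUmbrella H →
           InP 1 q F (CycleIndep H)
lemma4p5 _ _ F _ _ H U = incidence-represents H 0≉1 acyclic⇒prunable , pathwidth≤1
  where
  R : CommutativeRing 0ℓ 0ℓ
  R = FiniteField.ring F
  open CommutativeRing R using (_≈_; 0#; 1#)
  open IncidenceMatrix R
  open Umbrella U
  0≉1 : ¬ (0# ≈ 1#)
  0≉1 = IsField.0≉1 (FiniteField.isField F)
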